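{- For all matroids $L$, $M$, $N$: if $[L:M,N]\neq 0$, then $M\oplus N\le L\le M\mathbin{\Box} N$ in the weak order.
   Context: For a matroid $M$ on $S$, $\rho(M)$ is its rank, $\nu_M(A)=|A|-\rho_M(A)$, $\lambda_M(A)=\rho(M)-\rho_M(A)$. The free product $M\mathbin{\Box} N$ of $M$ on $S$ and $N$ on $T$ ($S\cap T=\emptyset$, after replacing by isomorphic copies if necessary) is the matroid on $S\cup T$ whose independent sets are the $A$ with $A\cap S$ independent in $M$ and $\lambda_M(A\cap S)\geq\nu_N(A\cap T)$; $M\oplus N$ is the direct sum. The section coefficient $[L:M,N]$ is the number of subsets $A$ of the ground set of $L$ such that $L|A\cong M$ and $L/A\cong N$. The weak order on isomorphism classes of matroids: $P\ge Q$ if and only if there is a bijection $f$ from the ground set of $P$ to that of $Q$ which is a weak map, i.e. $f^{ -1}(I)$ is independent in $P$ for every independent set $I$ of $Q$. -}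

module Defs where

open import Data.Nat using (ℕ; zero; suc; _+_; _∸_; _≤_; _⊔_)
open import Data.Bool using (Bool; true; false; T; _∧_; if_then_else_)
open import Data.Fin using (Fin; zero; suc)
open import Data.Fin.Subset using (Subset; _∈_; _∉_; _⊆_; _∪_; ⁅_⁆; ∣_∣; ∁)
open import Data.Fin.Subset.Properties using (_⊆?_)
open import Data.Vec using (Vec; []; _∷_; take; drop; lookup; tabulate)
open import Data.List using (List; []; _∷_; map; _++_; foldr; filterᵇ)
open import Data.Product using (Σ; ∃; _×_; _,_)
open import Relation.Nullary using (does)
open import Relation.Binary.PropositionalEquality using (_≡_)
open import Function.Definitions using (Injective; Bijective)
open import Function.Bundles using (_⇔_)

record Matroid (n : ℕ) : Set where
  field
    indep      : Subset n → Bool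
    empty-ind  : T (indep (Data.Fin.Subset.⊥))
    hereditary : ∀ (A B : Subset n) → B ⊆ A → T (indep A) → T (indep B)
    augment    : ∀ (A B : Subset n) → T (indep A) → T (indep B) →
                 suc ∣ A ∣ ≤ ∣ B ∣ →
                 ∃ λ x → x ∈ B × x ∉ A × T (indep (A ∪ ⁅ x ⁆))

open Matroid public

allSubsets : (n : ℕ) → List (Subset n)
allSubsets zero    = [] ∷ []
allSubsets (suc n) = map (true ∷_) (allSubsets n) ++ map (false ∷_) (allSubsets n)

maxList : List ℕ → ℕ
maxList = foldr _⊔_ 0

rk : ∀ {n} → Matroid n → Subset n → ℕ
rk {n} M A =
  maxList (map ∣_∣ (filterᵇ (λ X → does (X ⊆? A) ∧ indep M X) (allSubsets n)))

rank : ∀ {n} → Matroid n → ℕ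
rank {n} M = rk M (Data.Fin.Subset.⊤)

ν : ∀ {n} → Matroid n → Subset n → ℕ
ν M A = ∣ A ∣ ∸ rk M A

λM : ∀ {n} → Matroid n → Subset n → ℕ
λM M A = rank M ∸ rk M A

-- Independence systems as predicates (used for derived matroids)

IndepPred : ℕ → Set₁
IndepPred n = Subset n → Set

Ind : ∀ {n} → Matroid n → IndepPred n
Ind M X = T (indep M X)

-- Ground set of M ⊕ N and M □ N is Fin (m + k): S = first m, T = last k.
leftPart : ∀ {m k} → Subset (m + k) → Subset m
leftPart {m} A = take m A

rightPart : ∀ {m k} → Subset (m + k) → Subset k
rightPart {m} A = drop m A

directSumInd : ∀ {m k} → Matroid m → Matroid k → IndepPred (m + k)
directSumInd M N A = Ind M (leftPart A) × Ind N (rightPart A)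

freeProductInd : ∀ {m k} → Matroid m → Matroid k → IndepPred (m + k)
freeProductInd M N A =
  Ind M (leftPart A) × (ν N (rightPart A) ≤ λM M (leftPart A))

-- Restriction and contraction of L (on Fin n) to / by A, as independence
-- predicates on subsets of Fin n (meaningful on subsets of the ground set).

restrictInd : ∀ {n} → Matroid n → Subset n → IndepPred n
restrictInd L A X = X ⊆ A × Ind L X

contractInd : ∀ {n} → Matroid n → Subset n → IndepPred n
contractInd L A X = X ⊆ ∁ A × rk L (X ∪ A) ≡ ∣ X ∣ + rk L A

image : ∀ {m n} → (Fin m → Fin n) → Subset m → Subset n
image {zero}  e []      = Data.Fin.Subset.⊥
image {suc m} e (b ∷ X) =
  (if b then ⁅ e zero ⁆ else Data.Fin.Subset.⊥) ∪ image (λ i → e (suc i)) X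

-- M (on Fin m) is isomorphic to the matroid with ground set G ⊆ Fin n and
-- independence predicate P: there is a bijection e : Fin m → G
-- (an injection Fin m → Fin n with image exactly G) carrying the
-- independent sets of M exactly onto the P-independent subsets of G.
IsoOnto : ∀ {m n} → Matroid m → Subset n → IndepPred n → Set
IsoOnto {m} {n} M G P =
  Σ (Fin m → Fin n) λ e →
    Injective _≡_ _≡_ e ×
    (∀ (x : Fin n) → x ∈ G ⇔ (∃ λ i → e i ≡ x)) ×
    (∀ (X : Subset m) → Ind M X ⇔ P (image e X))

-- [L : M , N] ≠ 0 : some A ⊆ S has L|A ≅ M and L/A ≅ N
SectionNonzero : ∀ {n m k} → Matroid n → Matroid m → Matroid k → Set
SectionNonzero {n} L M N =
  ∃ λ (A : Subset n) →
    IsoOnto M A (restrictInd L A) × IsoOnto N (∁ A) (contractInd L A)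

-- Weak order: P ≥ Q iff there is a bijection f from the ground set of P to
-- that of Q such that f⁻¹(I) is P-independent for every Q-independent I.

preimage : ∀ {n₁ n₂} → (Fin n₁ → Fin n₂) → Subset n₂ → Subset n₁
preimage f I = tabulate (λ x → lookup I (f x))

WeakGe : ∀ {n₁ n₂} → IndepPred n₁ → IndepPred n₂ → Set
WeakGe {n₁} {n₂} P Q =
  Σ (Fin n₁ → Fin n₂) λ f →
    Bijective _≡_ _≡_ f × (∀ (I : Subset n₂) → Q I → P (preimage f I))

-- Identify the ground set of L with S ⊔ T, where S = A carries L|A ≅ M and its
-- complement carries L/A ≅ N.
-- M ⊕ N ≤ L: if Y is independent in L|A and X in L/A, extend Y by elements of a
-- basis of X ∪ A, which has size |X| + ρ(A); since at most ρ(A) of the resulting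
-- independent set lie in A, it must contain all of X, so X ∪ Y is independent.
-- L ≤ M □ N: for I independent in L, extend a basis of A by elements of I; the
-- part Z of the result outside A is independent in L/A and |I| ≤ ρ(A) + |Z|.
-- As ρ(A) ≤ ρ(M) and |Z| ≤ ρ_N(I ∖ A), this gives
-- |I ∩ A| + |I ∖ A| ≤ ρ(M) + ρ_N(I ∖ A), i.e. ν_N(I ∖ A) ≤ λ_M(I ∩ A).

module Submission where

open import Defs
open import Data.Nat using (ℕ; zero; suc; _+_; _∸_; _≤_; _<_; s≤s)
open import Data.Nat.Properties
open import Data.Bool using (Bool; true; false; T; _∧_)
open import Data.Bool.Properties using (T-∧)
open import Data.Fin using (Fin; zero; suc; _↑ˡ_; _↑ʳ_; join)
open import Data.Fin.Properties as Fin using (+↔⊎; splitAt-↑ˡ; splitAt-↑ʳ)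
open import Data.Fin.Subset
  using (Subset; _∈_; _∉_; _⊆_; _∪_; _∩_; ⁅_⁆; ∣_∣; ∁; ⊥)
open import Data.Fin.Subset.Properties
open import Data.Vec using ([]; _∷_; take; drop; lookup; tabulate; here; there)
open import Data.Vec.Properties using (tabulate-cong; lookup∘tabulate; []=⇒lookup; lookup⇒[]=)
open import Data.List using (map; filterᵇ)
import Data.List.Relation.Unary.Any as Any
open import Data.List.Membership.Propositional using () renaming (_∈_ to _∈ᴸ_)
open import Data.List.Membership.Propositional.Properties
  using (∈-++⁺ˡ; ∈-++⁺ʳ; ∈-map⁺; ∈-map⁻; ∈-filter⁺; ∈-filter⁻; foldr-selective)
open import Data.List.Properties using (foldr-preservesᵒ)
open import Data.Product using (∃; _×_; _,_; proj₁; proj₂)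
open import Data.Sum using (_⊎_; inj₁; inj₂; [_,_]′)
open import Function using (_∘_; _↔_; _⇔_; Inverse; Bijection; Equivalence)
open import Function.Bundles using (mk↔ₛ′)
open import Function.Definitions using (Injective)
open import Function.Properties.Inverse using (↔-sym; ↔-trans; ↔⇒⤖)
open import Relation.Nullary using (yes; no; does; contradiction)
open import Relation.Nullary.Decidable using (T?; toWitness; fromWitness; isYes≗does)
open import Relation.Binary.PropositionalEquality

m+n≤o+p⇒n∸p≤o∸m : ∀ m n o p → m + n ≤ o + p → n ∸ p ≤ o ∸ m
m+n≤o+p⇒n∸p≤o∸m zero    n o       p h       = m≤n+o⇒m∸n≤o n p (subst (n ≤_) (+-comm o p) h)
m+n≤o+p⇒n∸p≤o∸m (suc m) n zero    p h       =
  ≤-reflexive (m≤n⇒m∸n≡0 (≤-trans (m≤n+m n (suc m)) h))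
m+n≤o+p⇒n∸p≤o∸m (suc m) n (suc o) p (s≤s h) = m+n≤o+p⇒n∸p≤o∸m m n o p h

maxList-upper : ∀ {x xs} → x ∈ᴸ xs → x ≤ maxList xs
maxList-upper {x} {xs} x∈xs =
  foldr-preservesᵒ {P = x ≤_} (λ a b → [ m≤n⇒m≤n⊔o b , m≤n⇒m≤o⊔n a ]′)
    0 xs (inj₂ (Any.map ≤-reflexive x∈xs))

maxList-attained : ∀ xs → maxList xs ≡ 0 ⊎ maxList xs ∈ᴸ xs
maxList-attained = foldr-selective ⊔-sel 0

∈-allSubsets : ∀ {n} (X : Subset n) → X ∈ᴸ allSubsets n
∈-allSubsets []          = Any.here refl
∈-allSubsets (true ∷ X)  = ∈-++⁺ˡ (∈-map⁺ (true ∷_) (∈-allSubsets X))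
∈-allSubsets (false ∷ X) = ∈-++⁺ʳ _ (∈-map⁺ (false ∷_) (∈-allSubsets X))

∣p∣≡∣p∩q∣+∣p∩∁q∣ : ∀ {n} (p q : Subset n) → ∣ p ∣ ≡ ∣ p ∩ q ∣ + ∣ p ∩ ∁ q ∣
∣p∣≡∣p∩q∣+∣p∩∁q∣ []          []          = refl
∣p∣≡∣p∩q∣+∣p∩∁q∣ (true ∷ p)  (true ∷ q)  = cong suc (∣p∣≡∣p∩q∣+∣p∩∁q∣ p q)
∣p∣≡∣p∩q∣+∣p∩∁q∣ (true ∷ p)  (false ∷ q) =
  trans (cong suc (∣p∣≡∣p∩q∣+∣p∩∁q∣ p q)) (sym (+-suc _ _))
∣p∣≡∣p∩q∣+∣p∩∁q∣ (false ∷ p) (true ∷ q)  = ∣p∣≡∣p∩q∣+∣p∩∁q∣ p q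
∣p∣≡∣p∩q∣+∣p∩∁q∣ (false ∷ p) (false ∷ q) = ∣p∣≡∣p∩q∣+∣p∩∁q∣ p q

x∉p⇒∣⁅x⁆∪p∣≡1+∣p∣ : ∀ {n} {x : Fin n} {p : Subset n} → x ∉ p → ∣ ⁅ x ⁆ ∪ p ∣ ≡ suc ∣ p ∣
x∉p⇒∣⁅x⁆∪p∣≡1+∣p∣ {x = zero}  {false ∷ p} _   = cong (suc ∘ ∣_∣) (∪-identityˡ p)
x∉p⇒∣⁅x⁆∪p∣≡1+∣p∣ {x = zero}  {true ∷ p}  x∉p = contradiction here x∉p
x∉p⇒∣⁅x⁆∪p∣≡1+∣p∣ {x = suc x} {false ∷ p} x∉p = x∉p⇒∣⁅x⁆∪p∣≡1+∣p∣ (x∉p ∘ there)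
x∉p⇒∣⁅x⁆∪p∣≡1+∣p∣ {x = suc x} {true ∷ p}  x∉p = cong suc (x∉p⇒∣⁅x⁆∪p∣≡1+∣p∣ (x∉p ∘ there))

p⊆q∧∣q∣≤∣p∣⇒q⊆p : ∀ {n} {p q : Subset n} → p ⊆ q → ∣ q ∣ ≤ ∣ p ∣ → q ⊆ p
p⊆q∧∣q∣≤∣p∣⇒q⊆p {p = p} p⊆q ∣q∣≤∣p∣ {x} x∈q with x ∈? p
... | yes x∈p = x∈p
... | no  x∉p = contradiction (p⊂q⇒∣p∣<∣q∣ (p⊆q , x , x∈q , x∉p)) (≤⇒≯ ∣q∣≤∣p∣)

p⊆q∪r⇒p∩∁r⊆q : ∀ {n} {p q r : Subset n} → p ⊆ q ∪ r → p ∩ ∁ r ⊆ q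
p⊆q∪r⇒p∩∁r⊆q {q = q} {r} p⊆q∪r x∈p∩∁r with x∈p∩q⁻ _ _ x∈p∩∁r
... | x∈p , x∈∁r with x∈p∪q⁻ q r (p⊆q∪r x∈p)
...   | inj₁ x∈q = x∈q
...   | inj₂ x∈r = contradiction x∈r (x∈∁p⇒x∉p x∈∁r)

p⊆p∩∁q∪q : ∀ {n} (p q : Subset n) → p ⊆ (p ∩ ∁ q) ∪ q
p⊆p∩∁q∪q p q {x} x∈p with x ∈? q
... | yes x∈q = x∈p∪q⁺ (inj₂ x∈q)
... | no  x∉q = x∈p∪q⁺ (inj₁ (x∈p∩q⁺ (x∈p , x∉p⇒x∈∁p x∉q)))

x∉p⇒∣p∣<∣p∪⁅x⁆∣ : ∀ {n} {x : Fin n} {p : Subset n} → x ∉ p → ∣ p ∣ < ∣ p ∪ ⁅ x ⁆ ∣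
x∉p⇒∣p∣<∣p∪⁅x⁆∣ {x = x} x∉p = p⊂q⇒∣p∣<∣q∣ (p⊆p∪q ⁅ x ⁆ , x , x∈p∪q⁺ (inj₂ (x∈⁅x⁆ x)) , x∉p)

x∈q⇒p∪⁅x⁆∪q⊆p∪q : ∀ {n} {x : Fin n} {p q : Subset n} → x ∈ q → (p ∪ ⁅ x ⁆) ∪ q ⊆ p ∪ q
x∈q⇒p∪⁅x⁆∪q⊆p∪q {x = x} {p} {q} x∈q y∈ with x∈p∪q⁻ (p ∪ ⁅ x ⁆) q y∈
... | inj₂ y∈q = x∈p∪q⁺ (inj₂ y∈q)
... | inj₁ y∈p∪⁅x⁆ with x∈p∪q⁻ p ⁅ x ⁆ y∈p∪⁅x⁆
...   | inj₁ y∈p   = x∈p∪q⁺ (inj₁ y∈p)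
...   | inj₂ y∈⁅x⁆ = x∈p∪q⁺ (inj₂ (subst (_∈ q) (sym (x∈⁅y⁆⇒x≡y x y∈⁅x⁆)) x∈q))

∪-lub : ∀ {n} {p q r : Subset n} → p ⊆ r → q ⊆ r → p ∪ q ⊆ r
∪-lub {p = p} {q} p⊆r q⊆r = [ p⊆r , q⊆r ]′ ∘ x∈p∪q⁻ p q

image-∈⁺ : ∀ {m n} (e : Fin m → Fin n) (X : Subset m) {i} → i ∈ X → e i ∈ image e X
image-∈⁺ e (true ∷ X) here       = x∈p∪q⁺ (inj₁ (x∈⁅x⁆ (e zero)))
image-∈⁺ e (_ ∷ X)    (there i∈X) = x∈p∪q⁺ (inj₂ (image-∈⁺ (e ∘ suc) X i∈X))

image-∈⁻ : ∀ {m n} (e : Fin m → Fin n) (X : Subset m) {y} →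
           y ∈ image e X → ∃ λ i → i ∈ X × e i ≡ y
image-∈⁻ e [] y∈ = contradiction y∈ ∉⊥
image-∈⁻ e (true ∷ X) y∈ with x∈p∪q⁻ _ (image (e ∘ suc) X) y∈
... | inj₁ y∈⁅e0⁆ = zero , here , sym (x∈⁅y⁆⇒x≡y _ y∈⁅e0⁆)
... | inj₂ y∈rest with image-∈⁻ (e ∘ suc) X y∈rest
...   | i , i∈X , refl = suc i , there i∈X , refl
image-∈⁻ e (false ∷ X) y∈ with x∈p∪q⁻ ⊥ (image (e ∘ suc) X) y∈
... | inj₁ y∈⊥ = contradiction y∈⊥ ∉⊥
... | inj₂ y∈rest with image-∈⁻ (e ∘ suc) X y∈rest
...   | i , i∈X , refl = suc i , there i∈X , refl

∣image∣≡∣∣ : ∀ {m n} {e : Fin m → Fin n} → Injective _≡_ _≡_ e →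
             ∀ X → ∣ image e X ∣ ≡ ∣ X ∣
∣image∣≡∣∣ {n = n} e-inj []   = ∣⊥∣≡0 n
∣image∣≡∣∣ {e = e} e-inj (true ∷ X) =
  trans (x∉p⇒∣⁅x⁆∪p∣≡1+∣p∣ e0∉rest) (cong suc (∣image∣≡∣∣ (Fin.suc-injective ∘ e-inj) X))
  where
  e0∉rest : e zero ∉ image (e ∘ suc) X
  e0∉rest e0∈ with image-∈⁻ (e ∘ suc) X e0∈
  ... | _ , _ , eq with () ← e-inj eq
∣image∣≡∣∣ {e = e} e-inj (false ∷ X) =
  trans (cong ∣_∣ (∪-identityˡ (image (e ∘ suc) X))) (∣image∣≡∣∣ (Fin.suc-injective ∘ e-inj) X)

module _ {m n} (f : Fin m → Fin n) where

  ∈-preimage⁻ : ∀ {I x} → x ∈ preimage f I → f x ∈ I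
  ∈-preimage⁻ {I} {x} x∈ = lookup⇒[]= (f x) I (trans (sym (lookup∘tabulate _ x)) ([]=⇒lookup x∈))

  ∈-preimage⁺ : ∀ {I x} → f x ∈ I → x ∈ preimage f I
  ∈-preimage⁺ {I} {x} fx∈ = lookup⇒[]= x _ (trans (lookup∘tabulate _ x) ([]=⇒lookup fx∈))

  preimage-mono : ∀ {Z I} → Z ⊆ I → preimage f Z ⊆ preimage f I
  preimage-mono Z⊆I = ∈-preimage⁺ ∘ Z⊆I ∘ ∈-preimage⁻

  image-preimage⊆ : ∀ Z → image f (preimage f Z) ⊆ Z
  image-preimage⊆ Z y∈ with image-∈⁻ f _ y∈
  ... | _ , x∈ , refl = ∈-preimage⁻ x∈

take-tabulate : ∀ {A : Set} m {k} (h : Fin (m + k) → A) →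
                take m (tabulate h) ≡ tabulate (h ∘ (_↑ˡ k))
take-tabulate zero    h = refl
take-tabulate (suc m) h = cong (h zero ∷_) (take-tabulate m (h ∘ suc))

drop-tabulate : ∀ {A : Set} m {k} (h : Fin (m + k) → A) →
                drop m (tabulate h) ≡ tabulate (h ∘ (m ↑ʳ_))
drop-tabulate zero    h = refl
drop-tabulate (suc m) h = drop-tabulate m (h ∘ suc)

↑ˡ∈⇒∈take : ∀ m {k} (I : Subset (m + k)) {i} → i ↑ˡ k ∈ I → i ∈ take m I
↑ˡ∈⇒∈take (suc m) (_ ∷ I) {zero}  here         = here
↑ˡ∈⇒∈take (suc m) (_ ∷ I) {suc i} (there i∈I) = there (↑ˡ∈⇒∈take m I i∈I)

↑ʳ∈⇒∈drop : ∀ m {k} (I : Subset (m + k)) {j} → m ↑ʳ j ∈ I → j ∈ drop m I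
↑ʳ∈⇒∈drop zero    I       j∈I         = j∈I
↑ʳ∈⇒∈drop (suc m) (_ ∷ I) (there j∈I) = ↑ʳ∈⇒∈drop m I j∈I

module _ {n} (M : Matroid n) where

  private
    indepSubsetOf : Subset n → Subset n → Bool
    indepSubsetOf X Y = does (Y ⊆? X) ∧ indep M Y

  indep⊆⇒∣∣≤rk : ∀ {X Y} → Y ⊆ X → Ind M Y → ∣ Y ∣ ≤ rk M X
  indep⊆⇒∣∣≤rk {X} {Y} Y⊆X indY =
    maxList-upper (∈-map⁺ ∣_∣ (∈-filter⁺ (T? ∘ indepSubsetOf X) (∈-allSubsets Y)
      (Equivalence.from T-∧ (subst T (isYes≗does (Y ⊆? X)) (fromWitness {a? = Y ⊆? X} Y⊆X) , indY))))

  rk-basis : ∀ X → ∃ λ B → B ⊆ X × Ind M B × ∣ B ∣ ≡ rk M X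
  rk-basis X with maxList-attained (map ∣_∣ (filterᵇ (indepSubsetOf X) (allSubsets n)))
  ... | inj₁ rk≡0 = ⊥ , ⊥⊆ , empty-ind M , trans (∣⊥∣≡0 n) (sym rk≡0)
  ... | inj₂ rk∈ with ∈-map⁻ ∣_∣ rk∈
  ...   | B , B∈ , rk≡∣B∣ with ∈-filter⁻ (T? ∘ indepSubsetOf X) {xs = allSubsets n} B∈
  ...     | _ , B⊆X∧indB = let B⊆X , indB = Equivalence.to T-∧ B⊆X∧indB in
                           B , toWitness (subst T (sym (isYes≗does (B ⊆? X))) B⊆X) , indB , sym rk≡∣B∣

  indep⇒rk≡∣∣ : ∀ {X} → Ind M X → rk M X ≡ ∣ X ∣
  indep⇒rk≡∣∣ {X} indX =
    let B , B⊆X , _ , ∣B∣≡rk = rk-basis X in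
    ≤-antisym (subst (_≤ ∣ X ∣) ∣B∣≡rk (p⊆q⇒∣p∣≤∣q∣ B⊆X)) (indep⊆⇒∣∣≤rk ⊆-refl indX)

  indep⇒∣∩∣≤rk : ∀ {Y} A → Ind M Y → ∣ Y ∩ A ∣ ≤ rk M A
  indep⇒∣∩∣≤rk {Y} A indY = indep⊆⇒∣∣≤rk (p∩q⊆q Y A) (hereditary M Y _ (p∩q⊆p Y A) indY)

  rk-∪≤ : ∀ Z A → rk M (Z ∪ A) ≤ ∣ Z ∣ + rk M A
  rk-∪≤ Z A with rk-basis (Z ∪ A)
  ... | B , B⊆Z∪A , indB , ∣B∣≡rk = begin
    rk M (Z ∪ A)              ≡⟨ ∣B∣≡rk ⟨
    ∣ B ∣                     ≡⟨ ∣p∣≡∣p∩q∣+∣p∩∁q∣ B A ⟩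
    ∣ B ∩ A ∣ + ∣ B ∩ ∁ A ∣   ≤⟨ +-mono-≤ (indep⇒∣∩∣≤rk A indB) (p⊆q⇒∣p∣≤∣q∣ (p⊆q∪r⇒p∩∁r⊆q B⊆Z∪A)) ⟩
    rk M A + ∣ Z ∣            ≡⟨ +-comm (rk M A) ∣ Z ∣ ⟩
    ∣ Z ∣ + rk M A            ∎
    where open ≤-Reasoning

  extend : ∀ {T Y} → Ind M T → Ind M Y →
           ∃ λ Y′ → Ind M Y′ × Y ⊆ Y′ × Y′ ⊆ Y ∪ T × ∣ T ∣ ≤ ∣ Y′ ∣
  extend {T} {Y} indT indY = extendWithin ∣ T ∣ indY (m≤m+n ∣ T ∣ ∣ Y ∣)
    where
    extendWithin : ∀ d {Y} → Ind M Y → ∣ T ∣ ≤ d + ∣ Y ∣ →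
                   ∃ λ Y′ → Ind M Y′ × Y ⊆ Y′ × Y′ ⊆ Y ∪ T × ∣ T ∣ ≤ ∣ Y′ ∣
    extendWithin d {Y} indY bound with ∣ T ∣ ≤? ∣ Y ∣
    ... | yes T≤Y = Y , indY , ⊆-refl , p⊆p∪q T , T≤Y
    extendWithin zero    indY bound | no T≰Y = contradiction bound T≰Y
    extendWithin (suc d) {Y} indY bound | no T≰Y
      with x , x∈T , x∉Y , indY+x ← augment M Y T indY indT (≰⇒> T≰Y)
      with Y′ , indY′ , Y+x⊆Y′ , Y′⊆Y+x∪T , T≤Y′ ← extendWithin d indY+x
             (≤-trans bound (subst (_≤ d + ∣ Y ∪ ⁅ x ⁆ ∣) (+-suc d ∣ Y ∣)
               (+-monoʳ-≤ d (x∉p⇒∣p∣<∣p∪⁅x⁆∣ x∉Y))))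
      = Y′ , indY′ , Y+x⊆Y′ ∘ p⊆p∪q ⁅ x ⁆ , ⊆-trans Y′⊆Y+x∪T (x∈q⇒p∪⁅x⁆∪q⊆p∪q x∈T) , T≤Y′

  restrictInd∪contractInd⇒indep : ∀ {A Y X} → restrictInd M A Y → contractInd M A X → Ind M (Y ∪ X)
  restrictInd∪contractInd⇒indep {A} {Y} {X} (Y⊆A , indY) (_ , rk[X∪A]≡)
    with B , B⊆X∪A , indB , ∣B∣≡rk ← rk-basis (X ∪ A)
    with Y′ , indY′ , Y⊆Y′ , Y′⊆Y∪B , B≤Y′ ← extend indB indY
    = hereditary M Y′ (Y ∪ X) (∪-lub Y⊆Y′ X⊆Y′) indY′
    where
    Y′∩∁A⊆X : Y′ ∩ ∁ A ⊆ X
    Y′∩∁A⊆X = p⊆q∪r⇒p∩∁r⊆q (⊆-trans Y′⊆Y∪B (∪-lub (q⊆p∪q X A ∘ Y⊆A) B⊆X∪A))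

    ∣X∣≤∣Y′∩∁A∣ : ∣ X ∣ ≤ ∣ Y′ ∩ ∁ A ∣
    ∣X∣≤∣Y′∩∁A∣ = +-cancelʳ-≤ (rk M A) ∣ X ∣ ∣ Y′ ∩ ∁ A ∣ (begin
      ∣ X ∣ + rk M A              ≡⟨ trans ∣B∣≡rk rk[X∪A]≡ ⟨
      ∣ B ∣                       ≤⟨ B≤Y′ ⟩
      ∣ Y′ ∣                      ≡⟨ ∣p∣≡∣p∩q∣+∣p∩∁q∣ Y′ A ⟩
      ∣ Y′ ∩ A ∣ + ∣ Y′ ∩ ∁ A ∣   ≤⟨ +-monoˡ-≤ _ (indep⇒∣∩∣≤rk A indY′) ⟩
      rk M A + ∣ Y′ ∩ ∁ A ∣       ≡⟨ +-comm (rk M A) _ ⟩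
      ∣ Y′ ∩ ∁ A ∣ + rk M A       ∎)
      where open ≤-Reasoning

    X⊆Y′ : X ⊆ Y′
    X⊆Y′ = p∩q⊆p Y′ (∁ A) ∘ p⊆q∧∣q∣≤∣p∣⇒q⊆p Y′∩∁A⊆X ∣X∣≤∣Y′∩∁A∣

  indep⇒large-contractInd-⊆ : ∀ A {I} → Ind M I →
    ∃ λ Z → Z ⊆ I × contractInd M A Z × ∣ I ∣ ≤ rk M A + ∣ Z ∣
  indep⇒large-contractInd-⊆ A {I} indI
    with B , B⊆A , indB , ∣B∣≡rk ← rk-basis A
    with B′ , indB′ , B⊆B′ , B′⊆B∪I , I≤B′ ← extend indI indB
    = Z , Z⊆I , (p∩q⊆q B′ (∁ A) , rk[Z∪A]≡) , ≤-trans I≤B′ (≤-reflexive ∣B′∣≡)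
    where
    Z = B′ ∩ ∁ A

    Z⊆I : Z ⊆ I
    Z⊆I = p⊆q∪r⇒p∩∁r⊆q (⊆-trans B′⊆B∪I (∪-lub (q⊆p∪q I A ∘ B⊆A) (p⊆p∪q A)))

    ∣B′∩A∣≡rk : ∣ B′ ∩ A ∣ ≡ rk M A
    ∣B′∩A∣≡rk = ≤-antisym (indep⇒∣∩∣≤rk A indB′)
      (subst (_≤ ∣ B′ ∩ A ∣) ∣B∣≡rk (p⊆q⇒∣p∣≤∣q∣ (λ x∈B → x∈p∩q⁺ (B⊆B′ x∈B , B⊆A x∈B))))

    ∣B′∣≡ : ∣ B′ ∣ ≡ rk M A + ∣ Z ∣
    ∣B′∣≡ = trans (∣p∣≡∣p∩q∣+∣p∩∁q∣ B′ A) (cong (_+ ∣ Z ∣) ∣B′∩A∣≡rk)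

    rk[Z∪A]≡ : rk M (Z ∪ A) ≡ ∣ Z ∣ + rk M A
    rk[Z∪A]≡ = ≤-antisym (rk-∪≤ Z A)
      (subst (_≤ rk M (Z ∪ A)) (trans ∣B′∣≡ (+-comm (rk M A) ∣ Z ∣))
        (indep⊆⇒∣∣≤rk (p⊆p∩∁q∪q B′ A) indB′))

module IsoOntoProperties {m n} {M : Matroid m} {G : Subset n} {P : IndepPred n}
                         (iso : IsoOnto M G P) where

  e : Fin m → Fin n
  e = proj₁ iso

  injective : Injective _≡_ _≡_ e
  injective = proj₁ (proj₂ iso)

  onto : ∀ x → x ∈ G ⇔ (∃ λ i → e i ≡ x)
  onto = proj₁ (proj₂ (proj₂ iso))

  image-preserves : ∀ {X} → Ind M X → P (image e X)
  image-preserves = Equivalence.to (proj₂ (proj₂ (proj₂ iso)) _)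

  image-reflects : ∀ {X} → P (image e X) → Ind M X
  image-reflects = Equivalence.from (proj₂ (proj₂ (proj₂ iso)) _)

  image⊆G : ∀ X → image e X ⊆ G
  image⊆G X y∈ with image-∈⁻ e X y∈
  ... | i , _ , refl = Equivalence.from (onto (e i)) (i , refl)

  image-preimage : ∀ {Z} → Z ⊆ G → image e (preimage e Z) ≡ Z
  image-preimage {Z} Z⊆G = ⊆-antisym (image-preimage⊆ e Z) Z⊆image
    where
    Z⊆image : Z ⊆ image e (preimage e Z)
    Z⊆image {y} y∈Z with Equivalence.to (onto y) (Z⊆G y∈Z)
    ... | i , refl = image-∈⁺ e _ (∈-preimage⁺ e y∈Z)

  ∣preimage∣≡∣∣ : ∀ {Z} → Z ⊆ G → ∣ preimage e Z ∣ ≡ ∣ Z ∣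
  ∣preimage∣≡∣∣ Z⊆G = trans (sym (∣image∣≡∣∣ injective _)) (cong ∣_∣ (image-preimage Z⊆G))

  ∣preimage∣≤∣∩G∣ : ∀ I → ∣ preimage e I ∣ ≤ ∣ I ∩ G ∣
  ∣preimage∣≤∣∩G∣ I = subst (_≤ ∣ I ∩ G ∣) (∣image∣≡∣∣ injective _)
    (p⊆q⇒∣p∣≤∣q∣ (λ y∈ → x∈p∩q⁺ (image-preimage⊆ e I y∈ , image⊆G _ y∈)))

  ∣∣≤rk-preimage : ∀ {Z W} → Z ⊆ G → P Z → preimage e Z ⊆ W → ∣ Z ∣ ≤ rk M W
  ∣∣≤rk-preimage {Z} {W} Z⊆G PZ preimage⊆W = subst (_≤ rk M W) (∣preimage∣≡∣∣ Z⊆G)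
    (indep⊆⇒∣∣≤rk M preimage⊆W (image-reflects (subst P (sym (image-preimage Z⊆G)) PZ)))

module RestrictionIsoProperties {m n} {M : Matroid m} {L : Matroid n} {G : Subset n}
                                (iso : IsoOnto M G (restrictInd L G)) where

  open IsoOntoProperties {M = M} {G = G} {P = restrictInd L G} iso public

  preimage-indep : ∀ {I} → Ind L I → Ind M (preimage e I)
  preimage-indep {I} indI = image-reflects (image⊆G _ , hereditary L I _ (image-preimage⊆ e I) indI)

  rk≤rank : rk L G ≤ rank M
  rk≤rank with B , B⊆G , indB , ∣B∣≡rk ← rk-basis L G =
    subst (_≤ rank M) ∣B∣≡rk (∣∣≤rk-preimage B⊆G (B⊆G , indB) ⊆⊤)

module Partition {m k n} {G : Subset n} {e₁ : Fin m → Fin n} {e₂ : Fin k → Fin n}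
  (e₁-injective : Injective _≡_ _≡_ e₁) (e₁-onto : ∀ x → x ∈ G ⇔ (∃ λ i → e₁ i ≡ x))
  (e₂-injective : Injective _≡_ _≡_ e₂) (e₂-onto : ∀ x → x ∈ ∁ G ⇔ (∃ λ j → e₂ j ≡ x)) where

  classify : Fin n → Fin m ⊎ Fin k
  classify x with x ∈? G
  ... | yes x∈G = inj₁ (proj₁ (Equivalence.to (e₁-onto x) x∈G))
  ... | no  x∉G = inj₂ (proj₁ (Equivalence.to (e₂-onto x) (x∉p⇒x∈∁p x∉G)))

  copair-classify : ∀ x → [ e₁ , e₂ ]′ (classify x) ≡ x
  copair-classify x with x ∈? G
  ... | yes x∈G = proj₂ (Equivalence.to (e₁-onto x) x∈G)
  ... | no  x∉G = proj₂ (Equivalence.to (e₂-onto x) (x∉p⇒x∈∁p x∉G))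

  classify-copair : ∀ s → classify ([ e₁ , e₂ ]′ s) ≡ s
  classify-copair (inj₁ i) with e₁ i ∈? G
  ... | yes e₁i∈G = cong inj₁ (e₁-injective (proj₂ (Equivalence.to (e₁-onto (e₁ i)) e₁i∈G)))
  ... | no  e₁i∉G = contradiction (Equivalence.from (e₁-onto (e₁ i)) (i , refl)) e₁i∉G
  classify-copair (inj₂ j) with e₂ j ∈? G
  ... | yes e₂j∈G = contradiction e₂j∈G (x∈∁p⇒x∉p (Equivalence.from (e₂-onto (e₂ j)) (j , refl)))
  ... | no  e₂j∉G = cong inj₂ (e₂-injective (proj₂ (Equivalence.to (e₂-onto (e₂ j)) (x∉p⇒x∈∁p e₂j∉G))))

  partition : Fin n ↔ Fin (m + k)
  partition = ↔-trans (mk↔ₛ′ classify [ e₁ , e₂ ]′ classify-copair copair-classify) (↔-sym +↔⊎)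

  preimage-to⊆ : ∀ I → preimage (Inverse.to partition) I ⊆ image e₁ (take m I) ∪ image e₂ (drop m I)
  preimage-to⊆ I {x} x∈ = subst (_∈ _) (copair-classify x) (joined∈ (classify x) (∈-preimage⁻ _ x∈))
    where
    joined∈ : ∀ s → join m k s ∈ I → [ e₁ , e₂ ]′ s ∈ image e₁ (take m I) ∪ image e₂ (drop m I)
    joined∈ (inj₁ i) i∈I = x∈p∪q⁺ (inj₁ (image-∈⁺ e₁ _ (↑ˡ∈⇒∈take m I i∈I)))
    joined∈ (inj₂ j) j∈I = x∈p∪q⁺ (inj₂ (image-∈⁺ e₂ _ (↑ʳ∈⇒∈drop m I j∈I)))

  take-preimage-from : ∀ I → take m (preimage (Inverse.from partition) I) ≡ preimage e₁ I
  take-preimage-from I = trans (take-tabulate m _)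
    (tabulate-cong λ i → cong (lookup I ∘ [ e₁ , e₂ ]′) (splitAt-↑ˡ m i k))

  drop-preimage-from : ∀ I → drop m (preimage (Inverse.from partition) I) ≡ preimage e₂ I
  drop-preimage-from I = trans (drop-tabulate m _)
    (tabulate-cong λ j → cong (lookup I ∘ [ e₁ , e₂ ]′) (splitAt-↑ʳ m k j))

module Section {n m k} (L : Matroid n) (M : Matroid m) (N : Matroid k) {A : Subset n}
  (isoM : IsoOnto M A (restrictInd L A)) (isoN : IsoOnto N (∁ A) (contractInd L A)) where

  module EM = RestrictionIsoProperties {M = M} {L = L} {G = A} isoM
  module EN = IsoOntoProperties {M = N} {G = ∁ A} {P = contractInd L A} isoN
  open Partition EM.injective EM.onto EN.injective EN.onto

  directSum≤ : WeakGe (Ind L) (directSumInd M N)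
  directSum≤ = Inverse.to partition , Bijection.bijective (↔⇒⤖ partition) ,
    λ I (indM , indN) → hereditary L _ _ (preimage-to⊆ I)
      (restrictInd∪contractInd⇒indep L (EM.image-preserves indM) (EN.image-preserves indN))

  ν≤λ : ∀ {I} → Ind L I → ν N (preimage EN.e I) ≤ λM M (preimage EM.e I)
  ν≤λ {I} indI
    with Z , Z⊆I , Z∈L/A , ∣I∣≤ ← indep⇒large-contractInd-⊆ L A indI
    = subst (λ r → ∣ Y ∣ ∸ rk N Y ≤ rank M ∸ r) (sym (indep⇒rk≡∣∣ M (EM.preimage-indep indI)))
        (m+n≤o+p⇒n∸p≤o∸m ∣ X ∣ ∣ Y ∣ (rank M) (rk N Y) (begin
          ∣ X ∣ + ∣ Y ∣             ≤⟨ +-mono-≤ (EM.∣preimage∣≤∣∩G∣ I) (EN.∣preimage∣≤∣∩G∣ I) ⟩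
          ∣ I ∩ A ∣ + ∣ I ∩ ∁ A ∣   ≡⟨ ∣p∣≡∣p∩q∣+∣p∩∁q∣ I A ⟨
          ∣ I ∣                     ≤⟨ ∣I∣≤ ⟩
          rk L A + ∣ Z ∣            ≤⟨ +-mono-≤ EM.rk≤rank
                                         (EN.∣∣≤rk-preimage (proj₁ Z∈L/A) Z∈L/A (preimage-mono EN.e Z⊆I)) ⟩
          rank M + rk N Y           ∎))
    where
    open ≤-Reasoning
    X = preimage EM.e I
    Y = preimage EN.e I

  ≤freeProduct : WeakGe (freeProductInd M N) (Ind L)
  ≤freeProduct = Inverse.from partition , Bijection.bijective (↔⇒⤖ (↔-sym partition)) ,
    λ I indI → subst₂ (λ X Y → Ind M X × ν N Y ≤ λM M X)
      (sym (take-preimage-from I)) (sym (drop-preimage-from I)) (EM.preimage-indep indI , ν≤λ indI)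

proposition7p1 : ∀ {n m k : ℕ} (L : Matroid n) (M : Matroid m) (N : Matroid k) →
    SectionNonzero L M N →
    WeakGe (Ind L) (directSumInd M N) × WeakGe (freeProductInd M N) (Ind L)
proposition7p1 L M N (A , isoM , isoN) = directSum≤ , ≤freeProduct
  where open Section L M N isoM isoN
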